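{- Let $G$ be a $d$-hypergraph with edge-weight function $w:E(G)\to\mathbb N$ and let $S\subseteq V(G)$ with $|S|=k$. Let $t,q,p\in\mathbb N$ with $q\ge 2$ and $p=\lceil\log_q(t+1)\rceil$. The following are equivalent: (i) $t=\sum_{e\in E(G[S])}w(e)$; (ii) there is a sequence $c_0,c_1,\dots\in\{0,\dots,2\binom{k}{\le d}\}$ with $c_0=0$ such that for all $\ell\in\mathbb N$: $q c_{\ell+1}+t_\ell=c_\ell+\sum_{e\in E(G[S])}w_\ell(e)$; (iii) there is a sequence $c_0,c_1,\dots\in\{0,\dots,2\binom{k}{\le d}\}$ with $c_0=0$ such that $\sum_{\ell\in\mathbb N}\Big(c_\ell-t_\ell-qc_{\ell+1}+\sum_{e\in E(G[S])}w_\ell(e)\Big)^2=0$.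
   Context: A $d$-hypergraph $G$ has vertex set $V(G)$ and edge set $E(G)\subseteq\{e\subseteq V(G):|e|\le d\}$; $E(G[S])=\{e\in E(G):e\subseteq S\}$. $\binom{k}{\le d}=\sum_{i=0}^d\binom{k}{i}$. The $q$-expansion of $N\in\mathbb N$ is the unique sequence $N_0,N_1,\dots\in\{0,\dots,q-1\}$ with $N=\sum_{\ell}N_\ell q^\ell$; $t_\ell$ and $w_\ell(e)$ denote the $\ell$-th digits of the $q$-expansions of $t$ and $w(e)$. -}

module Defs where

open import Data.Nat using (ℕ; zero; suc; _+_; _*_; _^_; _≤_; NonZero)
open import Data.Nat.DivMod using (_/_; _%_)
open import Data.Nat.Combinatorics using (_C_)
open import Data.Integer as ℤ using (ℤ)
open import Data.List using (List; []; _∷_; map; filter)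
open import Data.List.Relation.Unary.All using (All)
open import Data.List.Relation.Unary.Unique.Propositional using (Unique)
open import Data.Fin.Subset using (Subset; ∣_∣; _⊆_)
open import Data.Fin.Subset.Properties using (_⊆?_)
open import Data.Product using (∃-syntax; _×_)

-- A d-hypergraph on vertex set V(G) = Fin n: a finite set of edges
-- (a duplicate-free list of subsets of Fin n), each of size at most d.
record Hypergraph (n d : ℕ) : Set where
  field
    edges  : List (Subset n)
    unique : Unique edges
    small  : All (λ e → ∣ e ∣ ≤ d) edges
open Hypergraph public

inducedEdges : ∀ {n d} → Hypergraph n d → Subset n → List (Subset n)
inducedEdges G S = filter (λ e → e ⊆? S) (edges G)

binom≤ : ℕ → ℕ → ℕ
binom≤ k zero    = k C 0
binom≤ k (suc d) = binom≤ k d + k C (suc d)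

digit : (q : ℕ) → .{{NonZero q}} → ℕ → ℕ → ℕ
digit q zero    N = N % q
digit q (suc ℓ) N = digit q ℓ (N / q)

IsCeilLog : ℕ → ℕ → ℕ → Set
IsCeilLog q x p = (x ≤ q ^ p) × (∀ p′ → x ≤ q ^ p′ → p ≤ p′)

partialSum : (ℕ → ℤ) → ℕ → ℤ
partialSum f zero    = ℤ.0ℤ
partialSum f (suc N) = partialSum f N ℤ.+ f N

-- the series Σ_{ℓ ∈ ℕ} f ℓ converges to 0 (in the discrete ℤ: partial sums are eventually 0)
SeriesEqZero : (ℕ → ℤ) → Set
SeriesEqZero f = ∃[ N₀ ] (∀ N → N₀ ≤ N → partialSum f N ≡ ℤ.0ℤ)
  where open import Relation.Binary.PropositionalEquality using (_≡_)

module Submission where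

-- For a carry sequence c (c 0 = 0, q·c (ℓ+1) + t_ℓ = c ℓ + Σ_e w_ℓ(e)) put
-- X ℓ = c ℓ + Σ_e ⌊w(e) / qˡ⌋.  The ℓ-th column equation is equivalent to the
-- recurrence X ℓ = q·X (ℓ+1) + t_ℓ, which is also satisfied by ⌊t / qˡ⌋.  If
-- t = Σ w(e), choosing c ℓ = ⌊t / qˡ⌋ − Σ_e ⌊w(e) / qˡ⌋ makes X ℓ = ⌊t / qˡ⌋, so
-- carries exist; conversely two solutions of the recurrence that are small at the
-- start and vanish far out must agree (a telescoping argument), giving Σ w(e) = t.
-- Carries never exceed the number of edges of G[S], which are distinct subsets of S
-- of size ≤ d and hence at most binom(k, ≤ d) many; this gives (i) ⇔ (ii).  Finally
-- (ii) ⇔ (iii) for each fixed c, since a series of integer squares vanishes exactly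
-- when every term does.

open import Defs
open import Data.Nat using (ℕ; zero; suc; _+_; _*_; _∸_; _^_; _≤_; _<_; NonZero; >-nonZero; z≤n; s≤s; s≤s⁻¹)
open import Data.Nat.Properties
open import Data.Nat.DivMod using (_/_; _%_; m≡m%n+[m/n]*n; m%n<n; m/n*n≤m; m*n/n≡m; /-monoˡ-≤; m<n*o⇒m/o<n)
open import Data.Nat.Combinatorics using (_C_; nCk+nC[k+1]≡[n+1]C[k+1])
open import Data.Nat.ListAction using (sum)
open import Data.Nat.Solver using (module +-*-Solver)
open import Data.Integer as ℤ using (ℤ; +_; 0ℤ)
import Data.Integer.Properties as ℤP
import Data.Integer.Solver as ℤSolver
open import Data.Bool using (false; true)
open import Data.Vec using ([]; _∷_; here)
open import Data.List using (List; []; _∷_; length; map)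
open import Data.List.Relation.Unary.All as All using (All; []; _∷_)
import Data.List.Relation.Unary.All.Properties as AllP
open import Data.List.Relation.Unary.AllPairs using ([]; _∷_)
open import Data.List.Relation.Unary.Unique.Propositional using (Unique)
import Data.List.Relation.Unary.Unique.Propositional.Properties as UniqueP
open import Data.Fin.Subset using (Subset; ∣_∣; _⊆_)
open import Data.Fin.Subset.Properties using (drop-∷-⊆; _⊆?_)
open import Data.Product using (Σ-syntax; _×_; _,_)
open import Data.Sum using (inj₁; inj₂)
open import Data.Empty using (⊥; ⊥-elim)
open import Relation.Binary.PropositionalEquality

-- Counting small subsets of S.

-- binom(k+1, ≤ d+1) = binom(k, ≤ d+1) + binom(k, ≤ d): Pascal's rule summed over i ≤ d+1.
binom≤-pascal : ∀ k d → binom≤ (suc k) (suc d) ≡ binom≤ k (suc d) + binom≤ k d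
binom≤-pascal k zero = begin
    1 + suc k C 1          ≡⟨ cong suc (sym (nCk+nC[k+1]≡[n+1]C[k+1] k 0)) ⟩
    1 + (1 + k C 1)        ≡⟨ +-comm 1 _ ⟩
    (1 + k C 1) + 1        ∎
  where open ≡-Reasoning
binom≤-pascal k (suc d) = begin
    binom≤ (suc k) (suc d) + suc k C suc (suc d)
      ≡⟨ cong₂ _+_ (binom≤-pascal k d) (sym (nCk+nC[k+1]≡[n+1]C[k+1] k (suc d))) ⟩
    (binom≤ k (suc d) + binom≤ k d) + (k C suc d + k C suc (suc d))
      ≡⟨ solve 4 (λ a b c e → (a :+ b) :+ (c :+ e) := (a :+ e) :+ (b :+ c)) refl
               (binom≤ k (suc d)) (binom≤ k d) (k C suc d) (k C suc (suc d)) ⟩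
    (binom≤ k (suc d) + k C suc (suc d)) + (binom≤ k d + k C suc d) ∎
  where open ≡-Reasoning
        open +-*-Solver

-- binom(k, ≤ d) counts at least the empty set.
binom≤-positive : ∀ k d → 1 ≤ binom≤ k d
binom≤-positive k zero    = ≤-refl
binom≤-positive k (suc d) = ≤-trans (binom≤-positive k d) (m≤m+n _ _)

avoiding0 containing0 : ∀ {n} → List (Subset (suc n)) → List (Subset n)
avoiding0 []                = []
avoiding0 ((false ∷ e) ∷ L) = e ∷ avoiding0 L
avoiding0 ((true  ∷ e) ∷ L) = avoiding0 L
containing0 []                = []
containing0 ((false ∷ e) ∷ L) = containing0 L
containing0 ((true  ∷ e) ∷ L) = e ∷ containing0 L

length-split : ∀ {n} (L : List (Subset (suc n)))
             → length L ≡ length (avoiding0 L) + length (containing0 L)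
length-split []                = refl
length-split ((false ∷ e) ∷ L) = cong suc (length-split L)
length-split ((true  ∷ e) ∷ L) =
  trans (cong suc (length-split L)) (sym (+-suc (length (avoiding0 L)) _))

module _ {p} {n} {P : Subset (suc n) → Set p} where
  All-avoiding0 : ∀ {L} → All P L → All (λ e → P (false ∷ e)) (avoiding0 L)
  All-avoiding0 {[]}                []         = []
  All-avoiding0 {(false ∷ e) ∷ L} (Pe ∷ PL) = Pe ∷ All-avoiding0 PL
  All-avoiding0 {(true  ∷ e) ∷ L} (Pe ∷ PL) = All-avoiding0 PL

  All-containing0 : ∀ {L} → All P L → All (λ e → P (true ∷ e)) (containing0 L)
  All-containing0 {[]}                []         = []
  All-containing0 {(false ∷ e) ∷ L} (Pe ∷ PL) = All-containing0 PL
  All-containing0 {(true  ∷ e) ∷ L} (Pe ∷ PL) = Pe ∷ All-containing0 PL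

Unique-avoiding0 : ∀ {n} {L : List (Subset (suc n))} → Unique L → Unique (avoiding0 L)
Unique-avoiding0 {L = []} [] = []
Unique-avoiding0 {L = (false ∷ e) ∷ L} (e∉L ∷ uL) =
  All.map (λ ne eq → ne (cong (false ∷_) eq)) (All-avoiding0 e∉L) ∷ Unique-avoiding0 uL
Unique-avoiding0 {L = (true ∷ e) ∷ L} (_ ∷ uL) = Unique-avoiding0 uL

Unique-containing0 : ∀ {n} {L : List (Subset (suc n))} → Unique L → Unique (containing0 L)
Unique-containing0 {L = []} [] = []
Unique-containing0 {L = (false ∷ e) ∷ L} (_ ∷ uL) = Unique-containing0 uL
Unique-containing0 {L = (true ∷ e) ∷ L} (e∉L ∷ uL) =
  All.map (λ ne eq → ne (cong (true ∷_) eq)) (All-containing0 e∉L) ∷ Unique-containing0 uL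

length-of-absurd : ∀ {a} {A : Set a} {xs : List A} → All (λ _ → ⊥) xs → length xs ≡ 0
length-of-absurd []      = refl
length-of-absurd (() ∷ _)

length-when-none-contain0 : ∀ {n} (L : List (Subset (suc n)))
                          → length (containing0 L) ≡ 0 → length L ≡ length (avoiding0 L)
length-when-none-contain0 L none = begin
    length L                                           ≡⟨ length-split L ⟩
    length (avoiding0 L) + length (containing0 L)      ≡⟨ cong (λ m → length (avoiding0 L) + m) none ⟩
    length (avoiding0 L) + 0                           ≡⟨ +-identityʳ _ ⟩
    length (avoiding0 L)                               ∎
  where open ≡-Reasoning

SmallSubsetOf : ∀ {n} → Subset n → ℕ → Subset n → Set
SmallSubsetOf S d e = e ⊆ S × ∣ e ∣ ≤ d

small-tail : ∀ {n} {S : Subset n} {d b s} {e : Subset n}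
           → SmallSubsetOf (s ∷ S) d (b ∷ e) → SmallSubsetOf S d e
small-tail {b = false} (e⊆S , size) = (λ {x} → drop-∷-⊆ e⊆S {x}) , size
small-tail {b = true}  (e⊆S , size) = (λ {x} → drop-∷-⊆ e⊆S {x}) , ≤-trans (n≤1+n _) size

small-tail-containing : ∀ {n} {S : Subset n} {d s} {e : Subset n}
                      → SmallSubsetOf (s ∷ S) (suc d) (true ∷ e) → SmallSubsetOf S d e
small-tail-containing (e⊆S , size) = (λ {x} → drop-∷-⊆ e⊆S {x}) , s≤s⁻¹ size

-- Induction on n, splitting the family at vertex 0: members avoiding 0
-- are small subsets of the tail of S, members containing 0 (possible only when
-- 0 ∈ S and d ≥ 1) give small subsets of size at most d − 1.
small-subsets-count : ∀ n (S : Subset n) d (L : List (Subset n))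
                    → Unique L → All (SmallSubsetOf S d) L → length L ≤ binom≤ ∣ S ∣ d
small-subsets-count zero [] d []                 _                 _ = z≤n
small-subsets-count zero [] d ([] ∷ [])          _                 _ = binom≤-positive 0 d
small-subsets-count zero [] d ([] ∷ [] ∷ L)     ((≢[] ∷ _) ∷ _)   _ = ⊥-elim (≢[] refl)
small-subsets-count (suc n) (false ∷ S) d L uL small =
  ≤-trans (≤-reflexive (length-when-none-contain0 L none-contain))
          (small-subsets-count n S d _ (Unique-avoiding0 uL) (All.map small-tail (All-avoiding0 small)))
  where
  0∉S : ∀ {e} → SmallSubsetOf (false ∷ S) d (true ∷ e) → ⊥
  0∉S (e⊆S , _) with e⊆S here
  ... | ()
  none-contain : length (containing0 L) ≡ 0
  none-contain = length-of-absurd (All.map 0∉S (All-containing0 small))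
small-subsets-count (suc n) (true ∷ S) zero L uL small =
  ≤-trans (≤-reflexive (length-when-none-contain0 L none-contain))
          (small-subsets-count n S zero _ (Unique-avoiding0 uL) (All.map small-tail (All-avoiding0 small)))
  where
  none-contain : length (containing0 L) ≡ 0
  none-contain = length-of-absurd (All.map (λ { (_ , ()) }) (All-containing0 small))
small-subsets-count (suc n) (true ∷ S) (suc d) L uL small = begin
    length L                                                   ≡⟨ length-split L ⟩
    length (avoiding0 L) + length (containing0 L)
      ≤⟨ +-mono-≤ (small-subsets-count n S (suc d) _ (Unique-avoiding0 uL) (All.map small-tail (All-avoiding0 small)))
                  (small-subsets-count n S d _ (Unique-containing0 uL)
                                       (All.map small-tail-containing (All-containing0 small))) ⟩
    binom≤ (∣ S ∣) (suc d) + binom≤ (∣ S ∣) d                  ≡⟨ binom≤-pascal ∣ S ∣ d ⟨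
    binom≤ (suc ∣ S ∣) (suc d)                                 ∎
  where open ≤-Reasoning

inducedEdges-count : ∀ {n d} (G : Hypergraph n d) (S : Subset n)
                   → length (inducedEdges G S) ≤ binom≤ ∣ S ∣ d
inducedEdges-count {n} {d} G S =
  small-subsets-count n S d _ (UniqueP.filter⁺ (_⊆? S) (unique G))
    (All.zipWith (λ (e⊆S , size) → (λ {x} → e⊆S {x}) , size)
                 (AllP.all-filter (_⊆? S) (edges G) , AllP.filter⁺ (_⊆? S) (small G)))

-- Vanishing series of integer squares.

partialSum-nonneg : ∀ (f : ℕ → ℤ) → (∀ ℓ → 0ℤ ℤ.≤ f ℓ) → ∀ N → 0ℤ ℤ.≤ partialSum f N
partialSum-nonneg f f≥0 zero    = ℤP.≤-refl
partialSum-nonneg f f≥0 (suc N) = ℤP.+-mono-≤ (partialSum-nonneg f f≥0 N) (f≥0 N)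

term≤partialSum : ∀ (f : ℕ → ℤ) → (∀ ℓ → 0ℤ ℤ.≤ f ℓ) → ∀ {ℓ} N → ℓ < N → f ℓ ℤ.≤ partialSum f N
term≤partialSum f f≥0 {ℓ} (suc N) ℓ<1+N with m≤n⇒m<n∨m≡n (s≤s⁻¹ ℓ<1+N)
... | inj₁ ℓ<N = begin
    f ℓ                          ≤⟨ term≤partialSum f f≥0 N ℓ<N ⟩
    partialSum f N               ≡⟨ ℤP.+-identityʳ _ ⟨
    partialSum f N ℤ.+ 0ℤ        ≤⟨ ℤP.+-monoʳ-≤ (partialSum f N) (f≥0 N) ⟩
    partialSum f N ℤ.+ f N       ∎
  where open ℤP.≤-Reasoning
... | inj₂ refl = begin
    f ℓ                          ≡⟨ ℤP.+-identityˡ (f ℓ) ⟨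
    0ℤ ℤ.+ f ℓ                   ≤⟨ ℤP.+-monoˡ-≤ (f ℓ) (partialSum-nonneg f f≥0 ℓ) ⟩
    partialSum f ℓ ℤ.+ f ℓ       ∎
  where open ℤP.≤-Reasoning

nonneg-series-zero⇒terms-zero : ∀ (f : ℕ → ℤ) → (∀ ℓ → 0ℤ ℤ.≤ f ℓ) → SeriesEqZero f → ∀ ℓ → f ℓ ≡ 0ℤ
nonneg-series-zero⇒terms-zero f f≥0 (N₀ , vanishes) ℓ = ℤP.≤-antisym fℓ≤0 (f≥0 ℓ)
  where
  fℓ≤0 : f ℓ ℤ.≤ 0ℤ
  fℓ≤0 = ℤP.≤-trans (term≤partialSum f f≥0 (suc ℓ + N₀) (s≤s (m≤m+n ℓ N₀)))
                    (ℤP.≤-reflexive (vanishes (suc ℓ + N₀) (m≤n+m N₀ (suc ℓ))))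

terms-zero⇒series-zero : ∀ (f : ℕ → ℤ) → (∀ ℓ → f ℓ ≡ 0ℤ) → SeriesEqZero f
terms-zero⇒series-zero f f≡0 = 0 , λ N _ → partialSum-zero N
  where
  partialSum-zero : ∀ N → partialSum f N ≡ 0ℤ
  partialSum-zero zero    = refl
  partialSum-zero (suc N) = cong₂ ℤ._+_ (partialSum-zero N) (f≡0 N)

square-nonneg : ∀ x → 0ℤ ℤ.≤ x ℤ.* x
square-nonneg (+ n)       = ℤP.≤-trans (ℤ.+≤+ z≤n) (ℤP.≤-reflexive (ℤP.pos-* n n))
square-nonneg ℤ.-[1+ n ]  = ℤ.+≤+ z≤n

square≡0⇒≡0 : ∀ x → x ℤ.* x ≡ 0ℤ → x ≡ 0ℤ
square≡0⇒≡0 x x²≡0 with ℤP.i*j≡0⇒i≡0∨j≡0 x x²≡0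
... | inj₁ x≡0 = x≡0
... | inj₂ x≡0 = x≡0

squares-series-zero⇒zero : ∀ (x : ℕ → ℤ) → SeriesEqZero (λ ℓ → x ℓ ℤ.* x ℓ) → ∀ ℓ → x ℓ ≡ 0ℤ
squares-series-zero⇒zero x series ℓ =
  square≡0⇒≡0 (x ℓ) (nonneg-series-zero⇒terms-zero _ (λ i → square-nonneg (x i)) series ℓ)

zero⇒squares-series-zero : ∀ (x : ℕ → ℤ) → (∀ ℓ → x ℓ ≡ 0ℤ) → SeriesEqZero (λ ℓ → x ℓ ℤ.* x ℓ)
zero⇒squares-series-zero x x≡0 = terms-zero⇒series-zero _ (λ ℓ → cong (λ y → y ℤ.* y) (x≡0 ℓ))

residual : (a b q c′ s : ℕ) → ℤ
residual a b q c′ s = (+ a) ℤ.- (+ b) ℤ.- (+ q) ℤ.* (+ c′) ℤ.+ (+ s)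

residual-as-difference : ∀ a b q c′ s → residual a b q c′ s ≡ + (a + s) ℤ.- + (q * c′ + b)
residual-as-difference a b q c′ s = begin
    (+ a) ℤ.- (+ b) ℤ.- (+ q) ℤ.* (+ c′) ℤ.+ (+ s)
      ≡⟨ solve 5 (λ A B Q C S → A :- B :- Q :* C :+ S := (A :+ S) :- (Q :* C :+ B)) refl (+ a) (+ b) (+ q) (+ c′) (+ s) ⟩
    ((+ a) ℤ.+ (+ s)) ℤ.- ((+ q) ℤ.* (+ c′) ℤ.+ (+ b))
      ≡⟨ cong₂ ℤ._-_ (ℤP.pos-+ a s) (trans (ℤP.pos-+ (q * c′) b) (cong (ℤ._+ (+ b)) (ℤP.pos-* q c′))) ⟨
    + (a + s) ℤ.- + (q * c′ + b) ∎
  where open ≡-Reasoning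
        open ℤSolver.+-*-Solver

residual≡0⇒equation : ∀ a b q c′ s → residual a b q c′ s ≡ 0ℤ → q * c′ + b ≡ a + s
residual≡0⇒equation a b q c′ s r≡0 =
  sym (ℤP.+-injective (ℤP.i-j≡0⇒i≡j _ _ (trans (sym (residual-as-difference a b q c′ s)) r≡0)))

equation⇒residual≡0 : ∀ a b q c′ s → q * c′ + b ≡ a + s → residual a b q c′ s ≡ 0ℤ
equation⇒residual≡0 a b q c′ s eq =
  trans (residual-as-difference a b q c′ s) (ℤP.i≡j⇒i-j≡0 (cong +_ (sym eq)))

-- Base-q shifts and digits.

regroup : ∀ q a b d → q * a + d + q * b ≡ q * (a + b) + d
regroup = solve 4 (λ Q a b d → Q :* a :+ d :+ Q :* b := Q :* (a :+ b) :+ d) refl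
  where open +-*-Solver

+-rotate : ∀ a b c → a + (b + c) ≡ a + c + b
+-rotate a b c = trans (cong (_+_ a) (+-comm b c)) (sym (+-assoc a c b))

-- Any two sequences obeying Z ℓ = q·Z (ℓ+1) + a ℓ for the same a satisfy
-- X 0 + qᴺ·Y N = Y 0 + qᴺ·X N: their difference is multiplied by q at every step.
same-recurrence : ∀ q (a X Y : ℕ → ℕ)
                → (∀ ℓ → X ℓ ≡ q * X (suc ℓ) + a ℓ) → (∀ ℓ → Y ℓ ≡ q * Y (suc ℓ) + a ℓ)
                → ∀ N → X 0 + q ^ N * Y N ≡ Y 0 + q ^ N * X N
same-recurrence q a X Y recX recY zero = begin
    X 0 + 1 * Y 0    ≡⟨ cong (_+_ (X 0)) (*-identityˡ (Y 0)) ⟩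
    X 0 + Y 0        ≡⟨ +-comm (X 0) (Y 0) ⟩
    Y 0 + X 0        ≡⟨ cong (_+_ (Y 0)) (*-identityˡ (X 0)) ⟨
    Y 0 + 1 * X 0    ∎
  where open ≡-Reasoning
same-recurrence q a X Y recX recY (suc N) = begin
    X 0 + q * q ^ N * Y (suc N)            ≡⟨ cong₂ _+_ (recX 0) (*-assoc q (q ^ N) _) ⟩
    q * X 1 + a 0 + q * (q ^ N * Y (suc N)) ≡⟨ regroup q (X 1) _ (a 0) ⟩
    q * (X 1 + q ^ N * Y (suc N)) + a 0     ≡⟨ cong (λ m → q * m + a 0) shifted ⟩
    q * (Y 1 + q ^ N * X (suc N)) + a 0     ≡⟨ regroup q (Y 1) _ (a 0) ⟨
    q * Y 1 + a 0 + q * (q ^ N * X (suc N)) ≡⟨ cong₂ _+_ (recY 0) (*-assoc q (q ^ N) _) ⟨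
    Y 0 + q * q ^ N * X (suc N)            ∎
  where
  open ≡-Reasoning
  shifted : X 1 + q ^ N * Y (suc N) ≡ Y 1 + q ^ N * X (suc N)
  shifted = same-recurrence q (λ ℓ → a (suc ℓ)) (λ ℓ → X (suc ℓ)) (λ ℓ → Y (suc ℓ))
                            (λ ℓ → recX (suc ℓ)) (λ ℓ → recY (suc ℓ)) N

same-recurrence-start : ∀ q (a X Y : ℕ → ℕ)
                      → (∀ ℓ → X ℓ ≡ q * X (suc ℓ) + a ℓ) → (∀ ℓ → Y ℓ ≡ q * Y (suc ℓ) + a ℓ)
                      → ∀ N → Y N ≡ 0 → X 0 < q ^ N → X 0 ≡ Y 0
same-recurrence-start q a X Y recX recY N YN≡0 X0<qᴺ with X N | same-recurrence q a X Y recX recY N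
... | zero  | telescope = begin
    X 0                 ≡⟨ +-identityʳ (X 0) ⟨
    X 0 + 0             ≡⟨ cong (_+_ (X 0)) (*-zeroʳ (q ^ N)) ⟨
    X 0 + q ^ N * 0     ≡⟨ cong (λ m → X 0 + q ^ N * m) YN≡0 ⟨
    X 0 + q ^ N * Y N   ≡⟨ telescope ⟩
    Y 0 + q ^ N * 0     ≡⟨ cong (_+_ (Y 0)) (*-zeroʳ (q ^ N)) ⟩
    Y 0 + 0             ≡⟨ +-identityʳ (Y 0) ⟩
    Y 0                 ∎
  where open ≡-Reasoning
... | suc m | telescope = ⊥-elim (<-irrefl refl (begin-strict
    X 0                 <⟨ X0<qᴺ ⟩
    q ^ N               ≤⟨ m≤m*n (q ^ N) (suc m) ⟩
    q ^ N * suc m       ≤⟨ m≤n+m _ (Y 0) ⟩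
    Y 0 + q ^ N * suc m ≡⟨ telescope ⟨
    X 0 + q ^ N * Y N   ≡⟨ cong (λ y → X 0 + q ^ N * y) YN≡0 ⟩
    X 0 + q ^ N * 0     ≡⟨ cong (_+_ (X 0)) (*-zeroʳ (q ^ N)) ⟩
    X 0 + 0             ≡⟨ +-identityʳ (X 0) ⟩
    X 0                 ∎))
  where open ≤-Reasoning

n<q^n : ∀ q → 2 ≤ q → ∀ n → n < q ^ n
n<q^n q 2≤q zero    = s≤s z≤n
n<q^n q 2≤q (suc n) = begin-strict
    suc n            ≤⟨ n<q^n q 2≤q n ⟩
    q ^ n            <⟨ m<m+n (q ^ n) (m^n>0 q n) ⟩
    q ^ n + q ^ n    ≡⟨ cong (_+_ (q ^ n)) (+-identityʳ (q ^ n)) ⟨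
    2 * q ^ n        ≤⟨ *-monoˡ-≤ (q ^ n) 2≤q ⟩
    q * q ^ n        ∎
  where
  open ≤-Reasoning
  instance
    q≢0 : NonZero q
    q≢0 = >-nonZero (≤-trans (s≤s z≤n) 2≤q)

module Digits (q : ℕ) .{{_ : NonZero q}} where

  shift : ℕ → ℕ → ℕ
  shift zero    N = N
  shift (suc ℓ) N = shift ℓ (N / q)

  shift-suc : ∀ ℓ N → shift (suc ℓ) N ≡ shift ℓ N / q
  shift-suc zero    N = refl
  shift-suc (suc ℓ) N = shift-suc ℓ (N / q)

  digit-shift : ∀ ℓ N → digit q ℓ N ≡ shift ℓ N % q
  digit-shift zero    N = refl
  digit-shift (suc ℓ) N = digit-shift ℓ (N / q)

  shift-split : ∀ ℓ N → shift ℓ N ≡ q * shift (suc ℓ) N + digit q ℓ N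
  shift-split ℓ N = begin
      shift ℓ N                          ≡⟨ m≡m%n+[m/n]*n (shift ℓ N) q ⟩
      shift ℓ N % q + shift ℓ N / q * q  ≡⟨ +-comm (shift ℓ N % q) _ ⟩
      shift ℓ N / q * q + shift ℓ N % q  ≡⟨ cong₂ _+_ (*-comm q (shift ℓ N / q)) (digit-shift ℓ N) ⟨
      q * (shift ℓ N / q) + digit q ℓ N  ≡⟨ cong (λ m → q * m + digit q ℓ N) (shift-suc ℓ N) ⟨
      q * shift (suc ℓ) N + digit q ℓ N  ∎
    where open ≡-Reasoning

  digit<q : ∀ ℓ N → digit q ℓ N < q
  digit<q ℓ N rewrite digit-shift ℓ N = m%n<n (shift ℓ N) q

  shift-vanishes : ∀ ℓ N → N < q ^ ℓ → shift ℓ N ≡ 0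
  shift-vanishes zero    N N<1 = n<1⇒n≡0 N<1
  shift-vanishes (suc ℓ) N N<qˡ⁺¹ =
    shift-vanishes ℓ (N / q) (m<n*o⇒m/o<n (subst (N <_) (*-comm q (q ^ ℓ)) N<qˡ⁺¹))

  /-superadditive : ∀ a b → a / q + b / q ≤ (a + b) / q
  /-superadditive a b = begin
      a / q + b / q              ≡⟨ m*n/n≡m (a / q + b / q) q ⟨
      (a / q + b / q) * q / q    ≤⟨ /-monoˡ-≤ q (begin
          (a / q + b / q) * q        ≡⟨ *-distribʳ-+ q (a / q) (b / q) ⟩
          a / q * q + b / q * q      ≤⟨ +-mono-≤ (m/n*n≤m a q) (m/n*n≤m b q) ⟩
          a + b                      ∎) ⟩
      (a + b) / q                ∎
    where open ≤-Reasoning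

  -- Column addition with carries, for the weights w(e) of a list E of items.

  module Columns {A : Set} (w : A → ℕ) where

    shiftSum digitSum : ℕ → List A → ℕ
    shiftSum ℓ E = sum (map (λ e → shift ℓ (w e)) E)
    digitSum ℓ E = sum (map (λ e → digit q ℓ (w e)) E)

    Carries : List A → ℕ → (ℕ → ℕ) → Set
    Carries E t c = ∀ ℓ → q * c (suc ℓ) + digit q ℓ t ≡ c ℓ + digitSum ℓ E

    shiftSum-split : ∀ ℓ E → shiftSum ℓ E ≡ q * shiftSum (suc ℓ) E + digitSum ℓ E
    shiftSum-split ℓ []      = sym (cong (_+ 0) (*-zeroʳ q))
    shiftSum-split ℓ (e ∷ E) = begin
        shift ℓ (w e) + shiftSum ℓ E
          ≡⟨ cong₂ _+_ (shift-split ℓ (w e)) (shiftSum-split ℓ E) ⟩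
        (q * shift (suc ℓ) (w e) + digit q ℓ (w e)) + (q * shiftSum (suc ℓ) E + digitSum ℓ E)
          ≡⟨ solve 5 (λ Q a b c d → (Q :* a :+ b) :+ (Q :* c :+ d) := Q :* (a :+ c) :+ (b :+ d)) refl q _ _ _ _ ⟩
        q * (shift (suc ℓ) (w e) + shiftSum (suc ℓ) E) + (digit q ℓ (w e) + digitSum ℓ E) ∎
      where open ≡-Reasoning
            open +-*-Solver

    shiftSum-suc≤ : ∀ ℓ E → shiftSum (suc ℓ) E ≤ shiftSum ℓ E / q
    shiftSum-suc≤ ℓ []      = z≤n
    shiftSum-suc≤ ℓ (e ∷ E) = begin
        shift (suc ℓ) (w e) + shiftSum (suc ℓ) E
          ≤⟨ +-mono-≤ (≤-reflexive (shift-suc ℓ (w e))) (shiftSum-suc≤ ℓ E) ⟩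
        shift ℓ (w e) / q + shiftSum ℓ E / q   ≤⟨ /-superadditive _ _ ⟩
        (shift ℓ (w e) + shiftSum ℓ E) / q     ∎
      where open ≤-Reasoning

    digitSum-bound : ∀ ℓ E → digitSum ℓ E + length E ≤ q * length E
    digitSum-bound ℓ []      = z≤n
    digitSum-bound ℓ (e ∷ E) = begin
        digit q ℓ (w e) + digitSum ℓ E + suc (length E)
          ≡⟨ solve 3 (λ a b c → a :+ b :+ (con 1 :+ c) := (con 1 :+ a) :+ (b :+ c)) refl
                   (digit q ℓ (w e)) (digitSum ℓ E) (length E) ⟩
        suc (digit q ℓ (w e)) + (digitSum ℓ E + length E)
          ≤⟨ +-mono-≤ (digit<q ℓ (w e)) (digitSum-bound ℓ E) ⟩
        q + q * length E                       ≡⟨ *-suc q (length E) ⟨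
        q * suc (length E)                     ∎
      where open ≤-Reasoning
            open +-*-Solver

    -- Carries starting from 0 never exceed the number of summands:
    -- q·c (ℓ+1) ≤ c ℓ + (q − 1)·|E| ≤ q·|E| by induction.
    carries-bounded : ∀ E t c → c 0 ≡ 0 → Carries E t c → ∀ ℓ → c ℓ ≤ length E
    carries-bounded E t c c0 carries zero    = ≤-trans (≤-reflexive c0) z≤n
    carries-bounded E t c c0 carries (suc ℓ) = *-cancelˡ-≤ q (begin
        q * c (suc ℓ)                       ≤⟨ m≤m+n _ _ ⟩
        q * c (suc ℓ) + digit q ℓ t         ≡⟨ carries ℓ ⟩
        c ℓ + digitSum ℓ E                  ≤⟨ +-monoˡ-≤ (digitSum ℓ E) (carries-bounded E t c c0 carries ℓ) ⟩
        length E + digitSum ℓ E             ≡⟨ +-comm (length E) _ ⟩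
        digitSum ℓ E + length E             ≤⟨ digitSum-bound ℓ E ⟩
        q * length E                        ∎)
      where open ≤-Reasoning

    -- carriedSum E c ℓ = c ℓ + Σ_e ⌊w(e) / qˡ⌋: the carry into column ℓ together with
    -- everything the columns ≥ ℓ of the weights still contribute.
    carriedSum : List A → (ℕ → ℕ) → ℕ → ℕ
    carriedSum E c ℓ = c ℓ + shiftSum ℓ E

    carriedSum-split : ∀ E c ℓ → carriedSum E c ℓ ≡ c ℓ + digitSum ℓ E + q * shiftSum (suc ℓ) E
    carriedSum-split E c ℓ = trans (cong (_+_ (c ℓ)) (shiftSum-split ℓ E)) (+-rotate (c ℓ) _ _)

    -- The column equation at ℓ is equivalent to the base-q recurrence of t for the
    -- carried sums: both sides differ by the same q·Σ_e ⌊w(e) / qˡ⁺¹⌋.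
    column⇒recurrence : ∀ E t c ℓ → q * c (suc ℓ) + digit q ℓ t ≡ c ℓ + digitSum ℓ E
                      → carriedSum E c ℓ ≡ q * carriedSum E c (suc ℓ) + digit q ℓ t
    column⇒recurrence E t c ℓ column = begin
        carriedSum E c ℓ                                     ≡⟨ carriedSum-split E c ℓ ⟩
        c ℓ + digitSum ℓ E + q * shiftSum (suc ℓ) E          ≡⟨ cong (_+ q * shiftSum (suc ℓ) E) column ⟨
        q * c (suc ℓ) + digit q ℓ t + q * shiftSum (suc ℓ) E ≡⟨ regroup q (c (suc ℓ)) _ (digit q ℓ t) ⟩
        q * carriedSum E c (suc ℓ) + digit q ℓ t             ∎
      where open ≡-Reasoning

    recurrence⇒column : ∀ E t c ℓ → carriedSum E c ℓ ≡ q * carriedSum E c (suc ℓ) + digit q ℓ t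
                      → q * c (suc ℓ) + digit q ℓ t ≡ c ℓ + digitSum ℓ E
    recurrence⇒column E t c ℓ recurrence = +-cancelʳ-≡ (q * shiftSum (suc ℓ) E) _ _ (begin
        q * c (suc ℓ) + digit q ℓ t + q * shiftSum (suc ℓ) E ≡⟨ regroup q (c (suc ℓ)) _ (digit q ℓ t) ⟩
        q * carriedSum E c (suc ℓ) + digit q ℓ t             ≡⟨ recurrence ⟨
        carriedSum E c ℓ                                     ≡⟨ carriedSum-split E c ℓ ⟩
        c ℓ + digitSum ℓ E + q * shiftSum (suc ℓ) E          ∎)
      where open ≡-Reasoning

    -- (i) ⇒ carries: if t = Σ w(e), then c ℓ = ⌊t / qˡ⌋ − Σ_e ⌊w(e) / qˡ⌋ is a carry
    -- sequence, because its carried sums are exactly ⌊t / qˡ⌋.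
    carries-of-sum : ∀ E t → t ≡ sum (map w E) → Σ[ c ∈ (ℕ → ℕ) ] (c 0 ≡ 0 × Carries E t c)
    carries-of-sum E t t≡ΣE = c , trans (cong (t ∸_) (sym t≡ΣE)) (n∸n≡0 t) , carries
      where
      shiftSum≤shift : ∀ ℓ → shiftSum ℓ E ≤ shift ℓ t
      shiftSum≤shift zero    = ≤-reflexive (sym t≡ΣE)
      shiftSum≤shift (suc ℓ) = begin
          shiftSum (suc ℓ) E   ≤⟨ shiftSum-suc≤ ℓ E ⟩
          shiftSum ℓ E / q     ≤⟨ /-monoˡ-≤ q (shiftSum≤shift ℓ) ⟩
          shift ℓ t / q        ≡⟨ shift-suc ℓ t ⟨
          shift (suc ℓ) t      ∎
        where open ≤-Reasoning

      c : ℕ → ℕ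
      c ℓ = shift ℓ t ∸ shiftSum ℓ E

      carriedSum≡shift : ∀ ℓ → carriedSum E c ℓ ≡ shift ℓ t
      carriedSum≡shift ℓ = m∸n+n≡m (shiftSum≤shift ℓ)

      carries : Carries E t c
      carries ℓ = recurrence⇒column E t c ℓ (begin
          carriedSum E c ℓ                            ≡⟨ carriedSum≡shift ℓ ⟩
          shift ℓ t                                   ≡⟨ shift-split ℓ t ⟩
          q * shift (suc ℓ) t + digit q ℓ t           ≡⟨ cong (λ m → q * m + digit q ℓ t) (carriedSum≡shift (suc ℓ)) ⟨
          q * carriedSum E c (suc ℓ) + digit q ℓ t    ∎)
        where open ≡-Reasoning

    -- carries ⇒ (i): the carried sums obey the same recurrence as ⌊t / qˡ⌋; at
    -- N = Σ w(e) + t we have ⌊t / qᴺ⌋ = 0 and carriedSum 0 = Σ w(e) < qᴺ, forcing Σ w(e) = t.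
    sum-of-carries : 2 ≤ q → ∀ E t c → c 0 ≡ 0 → Carries E t c → t ≡ sum (map w E)
    sum-of-carries 2≤q E t c c0 carries = begin
        t                     ≡⟨ start≡t ⟨
        carriedSum E c 0      ≡⟨ cong (_+ sum (map w E)) c0 ⟩
        sum (map w E)         ∎
      where
      open ≡-Reasoning
      N : ℕ
      N = sum (map w E) + t

      N<qᴺ : N < q ^ N
      N<qᴺ = n<q^n q 2≤q N

      start<qᴺ : carriedSum E c 0 < q ^ N
      start<qᴺ = ≤-<-trans (≤-trans (≤-reflexive (cong (_+ sum (map w E)) c0)) (m≤m+n _ t)) N<qᴺ

      start≡t : carriedSum E c 0 ≡ t
      start≡t = same-recurrence-start q (λ ℓ → digit q ℓ t) (carriedSum E c) (λ ℓ → shift ℓ t)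
                  (λ ℓ → column⇒recurrence E t c ℓ (carries ℓ)) (λ ℓ → shift-split ℓ t)
                  N (shift-vanishes N t (≤-<-trans (m≤n+m t _) N<qᴺ)) start<qᴺ

    columnResidual : List A → ℕ → (ℕ → ℕ) → ℕ → ℤ
    columnResidual E t c ℓ = residual (c ℓ) (digit q ℓ t) q (c (suc ℓ)) (digitSum ℓ E)

    SquaredResidualsVanish : List A → ℕ → (ℕ → ℕ) → Set
    SquaredResidualsVanish E t c = SeriesEqZero (λ ℓ → columnResidual E t c ℓ ℤ.* columnResidual E t c ℓ)

    carries⇒squares : ∀ E t c → Carries E t c → SquaredResidualsVanish E t c
    carries⇒squares E t c carries = zero⇒squares-series-zero (columnResidual E t c)
      (λ ℓ → equation⇒residual≡0 (c ℓ) (digit q ℓ t) q (c (suc ℓ)) (digitSum ℓ E) (carries ℓ))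

    squares⇒carries : ∀ E t c → SquaredResidualsVanish E t c → Carries E t c
    squares⇒carries E t c squares ℓ = residual≡0⇒equation (c ℓ) (digit q ℓ t) q (c (suc ℓ)) (digitSum ℓ E)
      (squares-series-zero⇒zero (columnResidual E t c) squares ℓ)

-- The theorem.

lemma3p3 : ∀ {n d : ℕ} (G : Hypergraph n d) (w : Subset n → ℕ) (S : Subset n) (k : ℕ)
    → ∣ S ∣ ≡ k
    → (t q p : ℕ) .{{_ : NonZero q}} → 2 ≤ q → IsCeilLog q (t + 1) p
    → let E = inducedEdges G S
          B = 2 * binom≤ k d
          I = t ≡ sum (map w E)
          II = Σ[ c ∈ (ℕ → ℕ) ] ((∀ ℓ → c ℓ ≤ B) × (c 0 ≡ 0)
                 × (∀ ℓ → q * c (suc ℓ) + digit q ℓ t ≡ c ℓ + sum (map (λ e → digit q ℓ (w e)) E)))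
          III = Σ[ c ∈ (ℕ → ℕ) ] ((∀ ℓ → c ℓ ≤ B) × (c 0 ≡ 0)
                 × SeriesEqZero (λ ℓ → let x = (+ c ℓ) ℤ.- (+ digit q ℓ t) ℤ.- (+ q) ℤ.* (+ c (suc ℓ))
                                                ℤ.+ (+ sum (map (λ e → digit q ℓ (w e)) E))
                                       in x ℤ.* x))
      in ((I → II) × (II → I)) × ((I → III) × (III → I))
lemma3p3 {n} {d} G w S k |S|≡k t q p 2≤q _ = (I⇒II , II⇒I) , (I⇒III , III⇒I)
  where
  open Digits q
  open Columns w

  E : List (Subset n)
  E = inducedEdges G S

  B : ℕ
  B = 2 * binom≤ k d

  BoundedFromZero : ((ℕ → ℕ) → Set) → Set
  BoundedFromZero P = Σ[ c ∈ (ℕ → ℕ) ] ((∀ ℓ → c ℓ ≤ B) × (c 0 ≡ 0) × P c)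

  carry≤B : ∀ c → c 0 ≡ 0 → Carries E t c → ∀ ℓ → c ℓ ≤ B
  carry≤B c c0 carries ℓ = begin
      c ℓ               ≤⟨ carries-bounded E t c c0 carries ℓ ⟩
      length E          ≤⟨ inducedEdges-count G S ⟩
      binom≤ ∣ S ∣ d    ≡⟨ cong (λ m → binom≤ m d) |S|≡k ⟩
      binom≤ k d        ≤⟨ m≤m+n (binom≤ k d) _ ⟩
      B                 ∎
    where open ≤-Reasoning

  I⇒II : t ≡ sum (map w E) → BoundedFromZero (Carries E t)
  I⇒II t≡ΣE with carries-of-sum E t t≡ΣE
  ... | c , c0 , carries = c , carry≤B c c0 carries , c0 , carries

  II⇒I : BoundedFromZero (Carries E t) → t ≡ sum (map w E)
  II⇒I (c , _ , c0 , carries) = sum-of-carries 2≤q E t c c0 carries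

  I⇒III : t ≡ sum (map w E) → BoundedFromZero (SquaredResidualsVanish E t)
  I⇒III t≡ΣE with I⇒II t≡ΣE
  ... | c , c≤B , c0 , carries = c , c≤B , c0 , carries⇒squares E t c carries

  III⇒I : BoundedFromZero (SquaredResidualsVanish E t) → t ≡ sum (map w E)
  III⇒I (c , c≤B , c0 , squares) = II⇒I (c , c≤B , c0 , squares⇒carries E t c squares)
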